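{- Let $\mathfrak K=(K,\bigsqcup,\odot,{}^*,{\sim},e)$ be a semi-Foulis dynamic algebra and let $u\in\widetilde K$. Then the map $u\bullet(-):\widetilde K\to\widetilde K$ equals the Sasaki projection $\pi_u$ of the orthomodular lattice $(\widetilde K,\preceq,{}^\perp)$, i.e. $u\bullet v=u\wedge(u^\perp\vee v)$ for all $v\in\widetilde K$.
   Context: A unital involutive quantale is $(K,\bigsqcup,\odot,{}^*,e)$ with $(K,\bigsqcup)$ a complete join-semilattice (binary join $\sqcup$), $\odot$ associative, distributing over arbitrary joins in each argument, with two-sided unit $e$, and ${}^*$ with $x^{**}=x$, $(x\odot y)^*=y^*\odot x^*$, $(\bigsqcup_i x_i)^*=\bigsqcup_i x_i^*$. An involutive generalized dynamic algebra is $(K,\bigsqcup,\odot,{}^*,{\sim},e)$ with $(K,\bigsqcup,\odot,{}^*,e)$ a unital involutive quantale and ${\sim}:K\to K$ satisfying, for all $x,y\in K$ and all families $(x_i)$: (i) ${\sim}(x\odot{\sim}{\sim}y)={\sim}(x\odot y)$; (ii) ${\sim}(\bigsqcup_i{\sim}{\sim}x_i)={\sim}(\bigsqcup_i x_i)$; (iii) $({\sim}x)^*={\sim}x$; (iv) ${\sim}{\sim}({\sim}{\sim}x\odot y)={\sim}({\sim}x\sqcup{\sim}({\sim}x\sqcup y))$. Notation: $\widetilde K=\{{\sim}k:k\in K\}$; for $W\subseteq\widetilde K$, $\bigvee W:={\sim}{\sim}(\bigsqcup W)$; $k\preceq l$ iff $\bigvee\{k,l\}=l$; $w^\perp:={\sim}w$;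 $k\bullet v:={\sim}{\sim}(k\odot v)$. It is a semi-Foulis dynamic algebra if $(\widetilde K,\preceq,{}^\perp)$ is a complete orthomodular lattice (bounded lattice with $m\wedge m^\perp=0$, $m\vee m^\perp=1$, $m\le n\Rightarrow n^\perp\le m^\perp$, $m^{\perp\perp}=m$, and $m\le n\Rightarrow n=m\vee(m^\perp\wedge n)$). For an orthomodular lattice, the Sasaki projection onto $m$ is $\pi_m(x)=m\wedge(m^\perp\vee x)$. -}

module Defs where

open import Level using (0ℓ)
open import Data.Bool using (Bool; true; false; if_then_else_)
open import Data.Product using (Σ; _×_)
open import Relation.Binary.PropositionalEquality using (_≡_)
open import Relation.Binary.Structures using (IsPartialOrder)

-- The complete join-semilattice (K, ⨆) is
-- presented by its (induced) partial order _≤_ together with a join ⨆ of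
-- arbitrary families (I → K), I : Set, which is the least upper bound.
record UnitalInvolutiveQuantale : Set₁ where
  infixl 7 _⊙_
  infixl 6 _⊔_
  field
    K      : Set
    _≤_    : K → K → Set
    ≤-po   : IsPartialOrder _≡_ _≤_
    ⨆      : {I : Set} → (I → K) → K
    ⨆-ub   : {I : Set} (f : I → K) (i : I) → f i ≤ ⨆ f
    ⨆-lub  : {I : Set} (f : I → K) (y : K) → ((i : I) → f i ≤ y) → ⨆ f ≤ y
    _⊙_    : K → K → K
    e      : K
    _*     : K → K
    ⊙-assoc  : (x y z : K) → (x ⊙ y) ⊙ z ≡ x ⊙ (y ⊙ z)
    ⊙-idˡ    : (x : K) → e ⊙ x ≡ x
    ⊙-idʳ    : (x : K) → x ⊙ e ≡ x
    ⊙-distribˡ : {I : Set} (x : K) (f : I → K) → x ⊙ ⨆ f ≡ ⨆ (λ i → x ⊙ f i)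
    ⊙-distribʳ : {I : Set} (f : I → K) (x : K) → ⨆ f ⊙ x ≡ ⨆ (λ i → f i ⊙ x)
    *-invol  : (x : K) → (x *) * ≡ x
    *-antihom : (x y : K) → (x ⊙ y) * ≡ (y *) ⊙ (x *)
    *-⨆      : {I : Set} (f : I → K) → (⨆ f) * ≡ ⨆ (λ i → f i *)

  _⊔_ : K → K → K
  x ⊔ y = ⨆ (λ (b : Bool) → if b then x else y)

record InvolutiveGDA : Set₁ where
  field
    quantale : UnitalInvolutiveQuantale
  open UnitalInvolutiveQuantale quantale public
  infix 8 ∼_
  field
    ∼_ : K → K
    ∼-i   : (x y : K) → ∼ (x ⊙ ∼ ∼ y) ≡ ∼ (x ⊙ y)
    ∼-ii  : {I : Set} (f : I → K) → ∼ (⨆ (λ i → ∼ ∼ f i)) ≡ ∼ (⨆ f)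
    ∼-iii : (x : K) → (∼ x) * ≡ ∼ x
    ∼-iv  : (x y : K) → ∼ ∼ (∼ ∼ x ⊙ y) ≡ ∼ (∼ x ⊔ ∼ (∼ x ⊔ y))

  InK̃ : K → Set
  InK̃ x = Σ K (λ k → x ≡ ∼ k)

  ⋁ : {I : Set} → (I → K) → K
  ⋁ f = ∼ ∼ (⨆ f)

  _⪯_ : K → K → Set
  k ⪯ l = ⋁ (λ (b : Bool) → if b then k else l) ≡ l

  _ᗮ : K → K
  w ᗮ = ∼ w

  _•_ : K → K → K
  k • v = ∼ ∼ (k ⊙ v)

-- (P, ⪯, ⊥) is a complete orthomodular lattice, where the carrier is the
-- subset P of K (with equality inherited from K).  Binary meet/join,
-- bottom/top and arbitrary joins are given as data; since they are
-- characterised by the order they are unique.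
record IsCompleteOML {K : Set} (P : K → Set) (_⪯_ : K → K → Set) (⊥ : K → K) : Set₁ where
  field
    ⪯-refl    : ∀ {x} → P x → x ⪯ x
    ⪯-antisym : ∀ {x y} → P x → P y → x ⪯ y → y ⪯ x → x ≡ y
    ⪯-trans   : ∀ {x y z} → P x → P y → P z → x ⪯ y → y ⪯ z → x ⪯ z
    _∧_ : K → K → K
    _∨_ : K → K → K
    𝟘 𝟙 : K
    ∧-closed : ∀ {x y} → P x → P y → P (x ∧ y)
    ∨-closed : ∀ {x y} → P x → P y → P (x ∨ y)
    𝟘-closed : P 𝟘
    𝟙-closed : P 𝟙
    ∧-lb₁  : ∀ {x y} → P x → P y → (x ∧ y) ⪯ x
    ∧-lb₂  : ∀ {x y} → P x → P y → (x ∧ y) ⪯ y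
    ∧-glb  : ∀ {x y z} → P x → P y → P z → z ⪯ x → z ⪯ y → z ⪯ (x ∧ y)
    ∨-ub₁  : ∀ {x y} → P x → P y → x ⪯ (x ∨ y)
    ∨-ub₂  : ∀ {x y} → P x → P y → y ⪯ (x ∨ y)
    ∨-lub  : ∀ {x y z} → P x → P y → P z → x ⪯ z → y ⪯ z → (x ∨ y) ⪯ z
    𝟘-min  : ∀ {x} → P x → 𝟘 ⪯ x
    𝟙-max  : ∀ {x} → P x → x ⪯ 𝟙
    sup        : {I : Set} → (I → K) → K
    sup-closed : {I : Set} (f : I → K) → ((i : I) → P (f i)) → P (sup f)
    sup-ub     : {I : Set} (f : I → K) → ((i : I) → P (f i)) → (i : I) → f i ⪯ sup f
    sup-lub    : {I : Set} (f : I → K) → ((i : I) → P (f i)) → (y : K) → P y →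
                 ((i : I) → f i ⪯ y) → sup f ⪯ y
    ⊥-closed  : ∀ {m} → P m → P (⊥ m)
    ⊥-∧       : ∀ {m} → P m → (m ∧ ⊥ m) ≡ 𝟘
    ⊥-∨       : ∀ {m} → P m → (m ∨ ⊥ m) ≡ 𝟙
    ⊥-antitone : ∀ {m n} → P m → P n → m ⪯ n → ⊥ n ⪯ ⊥ m
    ⊥-invol   : ∀ {m} → P m → ⊥ (⊥ m) ≡ m
    orthomodular : ∀ {m n} → P m → P n → m ⪯ n → n ≡ (m ∨ (⊥ m ∧ n))

record SemiFoulisDA : Set₁ where
  field
    gda : InvolutiveGDA
  open InvolutiveGDA gda public
  field
    isCOML : IsCompleteOML InK̃ _⪯_ _ᗮ
  open IsCompleteOML isCOML public

sasaki : (𝔎 : SemiFoulisDA) → SemiFoulisDA.K 𝔎 → SemiFoulisDA.K 𝔎 → SemiFoulisDA.K 𝔎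
sasaki 𝔎 m x = m ∧ ((m ᗮ) ∨ x)
  where open SemiFoulisDA 𝔎

-- On K̃ the element ∼∼(x ⊔ y) is the least upper bound of x and y for ⪯, so the lattice join
-- of the orthomodular lattice K̃ is x ∨ y = ∼∼(x ⊔ y); in particular ∼(x ∨ y) = ∼(x ⊔ y),
-- because ∼∼∼ = ∼.  Axiom (iv) with x = ∼u rewrites u • v = ∼∼(∼∼u ⊙ v) as
-- ∼(∼u ⊔ ∼(∼u ⊔ v)) = (u⊥ ∨ (u⊥ ∨ v)⊥)⊥, which is u ∧ (u⊥ ∨ v) by De Morgan.
module Submission where

open import Defs
open import Level using (0ℓ)
open import Data.Bool using (Bool; true; false; if_then_else_)
open import Data.Product using (_,_)
open import Data.Unit using (⊤; tt)
open import Relation.Binary.PropositionalEquality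
  using (_≡_; refl; sym; trans; cong; subst; module ≡-Reasoning)
open import Relation.Binary.Structures using (IsPartialOrder)
open import Relation.Binary.Lattice.Bundles using (JoinSemilattice)
import Relation.Binary.Lattice.Properties.JoinSemilattice as JoinSemilatticeProperties

module QuantaleJoins (Q : UnitalInvolutiveQuantale) where
  open UnitalInvolutiveQuantale Q
  open IsPartialOrder ≤-po using (antisym; reflexive)

  ⨆-cong : {I : Set} {f g : I → K} → ((i : I) → f i ≡ g i) → ⨆ f ≡ ⨆ g
  ⨆-cong {f = f} {g} f≡g = antisym
    (⨆-lub f (⨆ g) (λ i → subst (_≤ ⨆ g) (sym (f≡g i)) (⨆-ub g i)))
    (⨆-lub g (⨆ f) (λ i → subst (_≤ ⨆ f) (f≡g i) (⨆-ub f i)))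

  ⨆-const : (x : K) → ⨆ {⊤} (λ _ → x) ≡ x
  ⨆-const x = antisym (⨆-lub _ x (λ _ → reflexive refl)) (⨆-ub _ tt)

  joinSemilattice : JoinSemilattice 0ℓ 0ℓ 0ℓ
  joinSemilattice = record
    { _≈_ = _≡_
    ; _≤_ = _≤_
    ; _∨_ = _⊔_
    ; isJoinSemilattice = record
      { isPartialOrder = ≤-po
      ; supremum       = λ x y →
          ⨆-ub _ true , ⨆-ub _ false ,
          λ z x≤z y≤z → ⨆-lub _ z λ { true → x≤z ; false → y≤z }
      }
    }

  open JoinSemilattice joinSemilattice public using (x≤x∨y; y≤x∨y)
  open JoinSemilatticeProperties joinSemilattice public using (∨-assoc; x≤y⇒x∨y≈y)

module GDAJoins (A : InvolutiveGDA) where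
  open InvolutiveGDA A
  open QuantaleJoins quantale

  ∼∼∼≡∼ : (x : K) → ∼ ∼ ∼ x ≡ ∼ x
  ∼∼∼≡∼ x = begin
    ∼ ∼ ∼ x                  ≡⟨ cong ∼_ (sym (⨆-const (∼ ∼ x))) ⟩
    ∼ ⨆ {⊤} (λ _ → ∼ ∼ x)    ≡⟨ ∼-ii (λ _ → x) ⟩
    ∼ ⨆ {⊤} (λ _ → x)        ≡⟨ cong ∼_ (⨆-const x) ⟩
    ∼ x                      ∎
    where open ≡-Reasoning

  ∼∼-K̃ : ∀ {m} → InK̃ m → ∼ ∼ m ≡ m
  ∼∼-K̃ (k , refl) = ∼∼∼≡∼ k

  ∼-⊔-∼∼ : (x y : K) → ∼ (∼ ∼ x ⊔ ∼ ∼ y) ≡ ∼ (x ⊔ y)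
  ∼-⊔-∼∼ x y = trans (cong ∼_ (⨆-cong λ { true → refl ; false → refl }))
                     (∼-ii (λ (b : Bool) → if b then x else y))

  ∼-⊔-∼∼ˡ : ∀ {z} → InK̃ z → (x : K) → ∼ (∼ ∼ x ⊔ z) ≡ ∼ (x ⊔ z)
  ∼-⊔-∼∼ˡ {z} z∈K̃ x = trans (cong (λ t → ∼ (∼ ∼ x ⊔ t)) (sym (∼∼-K̃ z∈K̃))) (∼-⊔-∼∼ x z)

  ∼-⊔-∼∼ʳ : ∀ {z} → InK̃ z → (y : K) → ∼ (z ⊔ ∼ ∼ y) ≡ ∼ (z ⊔ y)
  ∼-⊔-∼∼ʳ {z} z∈K̃ y = trans (cong (λ t → ∼ (t ⊔ ∼ ∼ y)) (sym (∼∼-K̃ z∈K̃))) (∼-⊔-∼∼ z y)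

  -- x ⪯ y unfolds to x ⊻ y ≡ y.
  infixl 6 _⊻_
  _⊻_ : K → K → K
  x ⊻ y = ∼ ∼ (x ⊔ y)

  ⊻-K̃ : (x y : K) → InK̃ (x ⊻ y)
  ⊻-K̃ x y = ∼ (x ⊔ y) , refl

  x⪯x⊻y : ∀ {x} → InK̃ x → (y : K) → x ⪯ (x ⊻ y)
  x⪯x⊻y {x} x∈K̃ y =
    cong ∼_ (trans (∼-⊔-∼∼ʳ x∈K̃ (x ⊔ y)) (cong ∼_ (x≤y⇒x∨y≈y (x≤x∨y x y))))

  y⪯x⊻y : (x : K) → ∀ {y} → InK̃ y → y ⪯ (x ⊻ y)
  y⪯x⊻y x {y} y∈K̃ =
    cong ∼_ (trans (∼-⊔-∼∼ʳ y∈K̃ (x ⊔ y)) (cong ∼_ (x≤y⇒x∨y≈y (y≤x∨y x y))))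

  ⊻-least : ∀ {x y z} → InK̃ x → InK̃ z → x ⪯ z → y ⪯ z → (x ⊻ y) ⪯ z
  ⊻-least {x} {y} {z} x∈K̃ z∈K̃ x⪯z y⪯z = begin
    ∼ ∼ (∼ ∼ (x ⊔ y) ⊔ z)   ≡⟨ cong ∼_ (∼-⊔-∼∼ˡ z∈K̃ (x ⊔ y)) ⟩
    ∼ ∼ ((x ⊔ y) ⊔ z)       ≡⟨ cong (λ t → ∼ ∼ t) (∨-assoc x y z) ⟩
    ∼ ∼ (x ⊔ (y ⊔ z))       ≡⟨ cong ∼_ (sym (∼-⊔-∼∼ʳ x∈K̃ (y ⊔ z))) ⟩
    ∼ ∼ (x ⊔ ∼ ∼ (y ⊔ z))   ≡⟨ cong (λ t → ∼ ∼ (x ⊔ t)) y⪯z ⟩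
    ∼ ∼ (x ⊔ z)             ≡⟨ x⪯z ⟩
    z                       ∎
    where open ≡-Reasoning

module Orthocomplement {K : Set} {P : K → Set} {_⪯_ : K → K → Set} {⊥ : K → K}
                       (L : IsCompleteOML P _⪯_ ⊥) where
  open IsCompleteOML L

  ⪯-⊥-shiftʳ : ∀ {x y} → P x → P y → x ⪯ ⊥ y → y ⪯ ⊥ x
  ⪯-⊥-shiftʳ {x} {y} px py x⪯⊥y =
    subst (_⪯ ⊥ x) (⊥-invol py) (⊥-antitone px (⊥-closed py) x⪯⊥y)

  ⪯-⊥-shiftˡ : ∀ {x y} → P x → P y → ⊥ x ⪯ y → ⊥ y ⪯ x
  ⪯-⊥-shiftˡ {x} {y} px py ⊥x⪯y =
    subst (⊥ y ⪯_) (⊥-invol px) (⊥-antitone (⊥-closed px) py ⊥x⪯y)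

  ∧-deMorgan : ∀ {x y} → P x → P y → (x ∧ y) ≡ ⊥ (⊥ x ∨ ⊥ y)
  ∧-deMorgan {x} {y} px py = ⪯-antisym px∧y p⊥[⊥x∨⊥y]
    (⪯-⊥-shiftʳ p⊥x∨⊥y px∧y (∨-lub (⊥-closed px) (⊥-closed py) (⊥-closed px∧y)
      (⊥-antitone px∧y px (∧-lb₁ px py))
      (⊥-antitone px∧y py (∧-lb₂ px py))))
    (∧-glb px py p⊥[⊥x∨⊥y]
      (⪯-⊥-shiftˡ px p⊥x∨⊥y (∨-ub₁ (⊥-closed px) (⊥-closed py)))
      (⪯-⊥-shiftˡ py p⊥x∨⊥y (∨-ub₂ (⊥-closed px) (⊥-closed py))))
    where
    px∧y = ∧-closed px py
    p⊥x∨⊥y = ∨-closed (⊥-closed px) (⊥-closed py)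
    p⊥[⊥x∨⊥y] = ⊥-closed p⊥x∨⊥y

module SemiFoulisJoins (𝔎 : SemiFoulisDA) where
  open SemiFoulisDA 𝔎
  open GDAJoins gda

  ∨≡⊻ : ∀ {x y} → InK̃ x → InK̃ y → (x ∨ y) ≡ (x ⊻ y)
  ∨≡⊻ {x} {y} x∈K̃ y∈K̃ = ⪯-antisym x∨y∈K̃ (⊻-K̃ x y)
    (∨-lub x∈K̃ y∈K̃ (⊻-K̃ x y) (x⪯x⊻y x∈K̃ y) (y⪯x⊻y x y∈K̃))
    (⊻-least x∈K̃ x∨y∈K̃ (∨-ub₁ x∈K̃ y∈K̃) (∨-ub₂ x∈K̃ y∈K̃))
    where x∨y∈K̃ = ∨-closed x∈K̃ y∈K̃

  ∼-∨ : ∀ {x y} → InK̃ x → InK̃ y → ∼ (x ∨ y) ≡ ∼ (x ⊔ y)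
  ∼-∨ x∈K̃ y∈K̃ = trans (cong ∼_ (∨≡⊻ x∈K̃ y∈K̃)) (∼∼∼≡∼ _)

lemma3p6 : (𝔎 : SemiFoulisDA) (u : SemiFoulisDA.K 𝔎) → SemiFoulisDA.InK̃ 𝔎 u →
    (v : SemiFoulisDA.K 𝔎) → SemiFoulisDA.InK̃ 𝔎 v →
    SemiFoulisDA._•_ 𝔎 u v ≡ sasaki 𝔎 u v
lemma3p6 𝔎 u u∈K̃ v v∈K̃ = begin
  ∼ ∼ (u ⊙ v)                     ≡⟨ cong (λ t → ∼ ∼ (t ⊙ v)) (sym (⊥-invol u∈K̃)) ⟩
  ∼ ∼ (∼ ∼ u ⊙ v)                 ≡⟨ ∼-iv u v ⟩
  ∼ (∼ u ⊔ ∼ (∼ u ⊔ v))           ≡⟨ cong (λ t → ∼ (∼ u ⊔ t)) (sym (∼-∨ ∼u∈K̃ v∈K̃)) ⟩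
  ∼ (∼ u ⊔ ∼ ((∼ u) ∨ v))         ≡⟨ sym (∼-∨ ∼u∈K̃ (⊥-closed ∼u∨v∈K̃)) ⟩
  ∼ ((∼ u) ∨ (∼ ((∼ u) ∨ v)))     ≡⟨ sym (∧-deMorgan u∈K̃ ∼u∨v∈K̃) ⟩
  u ∧ ((∼ u) ∨ v)                 ∎
  where
  open SemiFoulisDA 𝔎
  open SemiFoulisJoins 𝔎
  open Orthocomplement isCOML
  open ≡-Reasoning
  ∼u∈K̃ = ⊥-closed u∈K̃
  ∼u∨v∈K̃ = ∨-closed ∼u∈K̃ v∈K̃
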